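{- Let $n\ge 2$. The graph $\Gamma(\mathbb{Z}_n)$ is chordal if and only if $n=p^x$, $n=2p$, or $n=2p^2$ for some prime $p$ and positive integer $x$.
   Context: For a commutative ring $R$ with identity, the zero-divisor graph $\Gamma(R)$ is the simple undirected graph whose vertices are the nonzero zero-divisors of $R$, two distinct vertices $u,v$ being adjacent iff $uv=0$. A graph is chordal if every cycle of length greater than $3$ has a chord (an edge joining two non-consecutive vertices of the cycle). -}

module Defs where

open import Data.Nat using (ℕ; zero; suc; _+_; _*_; _∸_; _≤_; _<_)
open import Data.Nat.Divisibility using (_∣_)
open import Data.Fin using (Fin; toℕ)
open import Data.Product using (_×_; Σ; ∃; ∃-syntax)
open import Data.Sum using (_⊎_)
open import Relation.Nullary using (¬_)
open import Relation.Binary.PropositionalEquality using (_≡_; _≢_)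

-- A simple graph on (a subset of) ℕ: a vertex predicate and a symmetric,
-- irreflexive adjacency relation.
record Graph : Set₁ where
  field
    Vertex : ℕ → Set
    Adj    : ℕ → ℕ → Set

Consec : ∀ {k} → Fin k → Fin k → Set
Consec {k} i j = (toℕ j ≡ suc (toℕ i)) ⊎ ((suc (toℕ i) ≡ k) × (toℕ j ≡ 0))

IsCycle : Graph → (k : ℕ) → (Fin k → ℕ) → Set
IsCycle G k c =
  (∀ i → Graph.Vertex G (c i)) ×
  (∀ i j → c i ≡ c j → i ≡ j) ×
  (∀ i j → Consec i j → Graph.Adj G (c i) (c j))

HasChord : Graph → (k : ℕ) → (Fin k → ℕ) → Set
HasChord G k c =
  ∃[ i ] ∃[ j ] (i ≢ j × ¬ Consec i j × ¬ Consec j i × Graph.Adj G (c i) (c j))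

Chordal : Graph → Set
Chordal G = ∀ k → 3 < k → (c : Fin k → ℕ) → IsCycle G k c → HasChord G k c

-- ℤ_n represented by residues 0 ≤ a < n; a ↦ a mod n.
-- Nonzero zero-divisor of ℤ_n: 0 < a < n and a·b ≡ 0 (mod n) for some 0 < b < n.
IsZeroDivisor : ℕ → ℕ → Set
IsZeroDivisor n a = 0 < a × a < n × ∃[ b ] (0 < b × b < n × n ∣ a * b)

Γℤ : ℕ → Graph
Γℤ n = record
  { Vertex = IsZeroDivisor n
  ; Adj    = λ u v → IsZeroDivisor n u × IsZeroDivisor n v × u ≢ v × n ∣ u * v
  }

-- A vertex u dominates a neighbour v of Γ(ℤ_n) when ann(v) ⊆ ann(u): every other neighbour of v
-- is then a neighbour of u, so a cycle running through the edge uv has a chord. Hence Γ(ℤ_n) is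
-- chordal as soon as, for one fixed vertex z, the two ends of every edge avoiding z have
-- comparable annihilators. This holds for n = p^k (annihilators form a chain), for n = 2p (every
-- edge contains p) and for n = 2p² with p odd (take z = p²). Conversely, if n is not of this form
-- it has an odd prime factor p, say n = p^b·M with p ∤ M. If M ∤ 2p^b then, with P = p^b, the
-- residues M, P, 2M, 2P form an induced 4-cycle; otherwise M = 2 and b ≥ 3, and 2p, Q, 4p, 3Q
-- with Q = p^(b-1) do.

module Submission where

open import Defs
open import Data.Nat using (ℕ; _*_; _^_; _≤_)
open import Data.Nat.Primality using (Prime)
open import Data.Product using (_×_; ∃-syntax)
open import Data.Sum using (_⊎_)
open import Function.Bundles using (_⇔_)
open import Relation.Binary.PropositionalEquality using (_≡_)

open import Data.Nat using (zero; suc; _+_; _<_; z≤n; s≤s; z<s; NonZero; >-nonZero; nonTrivial⇒n>1; _≟_)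
open import Data.Nat.Properties
open import Data.Nat.Divisibility
open import Data.Nat.Primality
  using (prime⇒nonZero; prime⇒nonTrivial; prime⇒irreducible; euclidsLemma; prime[2]; ¬prime[1])
open import Data.Nat.Primality.Factorisation using (factorise)
open import Data.Nat.Coprimality using (Coprime; coprime-divisor)
open import Data.Nat.Induction using (<-wellFounded)
open import Data.List using ([]; _∷_)
open import Data.Nat.ListAction using (product)
open import Data.List.Relation.Unary.All using (_∷_)
open import Data.Fin using (Fin; toℕ; fromℕ; inject₁)
open import Data.Fin.Patterns using (0F; 1F; 2F; 3F)
open import Data.Fin.Properties using (toℕ-fromℕ; toℕ-inject₁; toℕ-injective; toℕ<n)
open import Data.Product using (_,_; proj₁)
import Data.Sum as Sum
open import Data.Sum using (inj₁; inj₂)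
open import Data.Empty using (⊥-elim)
open import Function using (_∘_; id; flip)
open import Induction.WellFounded using (Acc; acc)
open import Relation.Nullary using (¬_; Dec; yes; no; contradiction)
open import Relation.Nullary.Decidable using (from-no)
open import Relation.Unary using (Pred; _⊆_)
open import Relation.Binary.PropositionalEquality using (refl; sym; trans; cong; subst; subst₂; _≢_)
open import Function.Bundles using (mk⇔)

prime⇒2≤ : ∀ {p} → Prime p → 2 ≤ p
prime⇒2≤ {p} pp = nonTrivial⇒n>1 p {{prime⇒nonTrivial pp}}

prime∣prime⇒≡ : ∀ {q p} → Prime q → Prime p → q ∣ p → q ≡ p
prime∣prime⇒≡ pq pp q∣p with prime⇒irreducible pp q∣p
... | inj₁ refl = contradiction pq ¬prime[1]
... | inj₂ q≡p = q≡p

prime∣^⇒∣ : ∀ {q p} → Prime q → ∀ k → q ∣ p ^ k → q ∣ p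
prime∣^⇒∣ pq zero q∣1 = contradiction (subst Prime (∣1⇒≡1 q∣1) pq) ¬prime[1]
prime∣^⇒∣ {p = p} pq (suc k) q∣p^k+1 with euclidsLemma p (p ^ k) pq q∣p^k+1
... | inj₁ q∣p = q∣p
... | inj₂ q∣p^k = prime∣^⇒∣ pq k q∣p^k

odd-prime∤2 : ∀ {p} → Prime p → ¬ 2 ∣ p → ¬ p ∣ 2
odd-prime∤2 pp 2∤p p∣2 = 2∤p (∣-reflexive (sym (prime∣prime⇒≡ pp prime[2] p∣2)))

odd-prime∤2* : ∀ {p m} → Prime p → ¬ 2 ∣ p → ¬ p ∣ m → ¬ p ∣ 2 * m
odd-prime∤2* {m = m} pp 2∤p p∤m p∣2m =
  Sum.[ odd-prime∤2 pp 2∤p , p∤m ] (euclidsLemma 2 m pp p∣2m)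

prime∤⇒coprime : ∀ {p m} → Prime p → ¬ p ∣ m → Coprime m p
prime∤⇒coprime pp p∤m (d∣m , d∣p) with prime⇒irreducible pp d∣p
... | inj₁ d≡1 = d≡1
... | inj₂ refl = contradiction d∣m p∤m

∣p^*⇒∣ : ∀ {p m o} → Prime p → ¬ p ∣ m → ∀ k → m ∣ p ^ k * o → m ∣ o
∣p^*⇒∣ {m = m} {o} pp p∤m zero m∣1*o = subst (m ∣_) (*-identityˡ o) m∣1*o
∣p^*⇒∣ {p} {m} {o} pp p∤m (suc k) m∣p^k+1*o =
  ∣p^*⇒∣ pp p∤m k
    (coprime-divisor (prime∤⇒coprime pp p∤m) (subst (m ∣_) (*-assoc p (p ^ k) o) m∣p^k+1*o))

prime^-cancelʳ : ∀ {p u} → Prime p → ¬ p ∣ u → ∀ k {w} → p ^ k ∣ w * u → p ^ k ∣ w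
prime^-cancelʳ pp p∤u zero _ = 1∣ _
prime^-cancelʳ {p} {u} pp p∤u (suc k) {w} p^k+1∣wu with euclidsLemma w u pp (m*n∣⇒m∣ p (p ^ k) p^k+1∣wu)
... | inj₂ p∣u = contradiction p∣u p∤u
... | inj₁ (divides a refl) =
  subst (p * p ^ k ∣_) (*-comm p a) (*-monoʳ-∣ p (prime^-cancelʳ pp p∤u k p^k∣au))
  where
  a*p*u≡p*[a*u] : a * p * u ≡ p * (a * u)
  a*p*u≡p*[a*u] = trans (cong (_* u) (*-comm a p)) (*-assoc p a u)
  p^k∣au : p ^ k ∣ a * u
  p^k∣au = *-cancelˡ-∣ p {{prime⇒nonZero pp}} (subst (p * p ^ k ∣_) a*p*u≡p*[a*u] p^k+1∣wu)

m<n*m : ∀ m {n} .{{_ : NonZero m}} → 1 < n → m < n * m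
m<n*m m {n} 1<n = subst (m <_) (*-comm m n) (m<m*n m n 1<n)

∤2*⇒0< : ∀ {d m} → ¬ d ∣ 2 * m → 0 < m
∤2*⇒0< {d} {zero} d∤0 = contradiction (d ∣0) d∤0
∤2*⇒0< {m = suc _} _ = z<s

∤2*⇒3≤ : ∀ {d m} → 0 < d → ¬ d ∣ 2 * m → 3 ≤ d
∤2*⇒3≤ {1} _ 1∤2m = contradiction (1∣ _) 1∤2m
∤2*⇒3≤ {2} {m} _ 2∤2m = contradiction (m∣m*n m) 2∤2m
∤2*⇒3≤ {suc (suc (suc _))} _ _ = s≤s (s≤s (s≤s z≤n))

∣∧<2*⇒≡ : ∀ {d u} → d ∣ u → 0 < u → u < 2 * d → u ≡ d
∣∧<2*⇒≡ (divides (suc zero) refl) _ _ = *-identityˡ _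
∣∧<2*⇒≡ {d} (divides (suc (suc q)) refl) _ u<2d =
  contradiction u<2d (≤⇒≯ (*-monoˡ-≤ d {2} {suc (suc q)} (s≤s (s≤s z≤n))))

∃-prime-divisor : ∀ {m} → 2 ≤ m → ∃[ q ] (Prime q × q ∣ m)
∃-prime-divisor {m@(suc _)} 2≤m with factorise m
... | record { factors = [] ; isFactorisation = m≡1 } = contradiction m≡1 (<⇒≢ 2≤m ∘ sym)
... | record { factors = q ∷ qs ; isFactorisation = m≡q*qs ; factorsPrime = q-prime ∷ _ } =
  q , q-prime , divides (product qs) (trans m≡q*qs (*-comm q (product qs)))

prime-power-decomposition : ∀ {p} → Prime p → ∀ {n} → 0 < n →
  ∃[ a ] ∃[ m ] (n ≡ p ^ a * m × ¬ p ∣ m)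
prime-power-decomposition {p} pp {n} = go n (<-wellFounded n)
  where
  go : ∀ n → Acc _<_ n → 0 < n → ∃[ a ] ∃[ m ] (n ≡ p ^ a * m × ¬ p ∣ m)
  go n _ _ with p ∣? n
  go n _ _ | no p∤n = 0 , n , sym (*-identityˡ n) , p∤n
  go _ (acc rec) _ | yes (divides q@(suc _) refl) with go q (rec (m<m*n q p (prime⇒2≤ pp))) z<s
  ... | a , m , q≡p^a*m , p∤m = suc a , m , q*p≡p^[1+a]*m , p∤m
    where
    q*p≡p^[1+a]*m : q * p ≡ p * p ^ a * m
    q*p≡p^[1+a]*m = trans (*-comm q p) (trans (cong (p *_) q≡p^a*m) (sym (*-assoc p (p ^ a) m)))

-- Annihilators in ℤ_n

Ann : ℕ → ℕ → Pred ℕ _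
Ann n u w = n ∣ w * u

AnnComparable : ℕ → ℕ → ℕ → Set
AnnComparable n u v = Ann n v ⊆ Ann n u ⊎ Ann n u ⊆ Ann n v

ann-⊆-scale : ∀ d .{{_ : NonZero d}} {n a b} →
  Ann n a ⊆ Ann n b → Ann (d * n) (a * d) ⊆ Ann (d * n) (b * d)
ann-⊆-scale d {n} {a} {b} a⊆b {w} dn∣wad =
  subst (d * n ∣_) (d*[w*x]≡w*[x*d] b) (*-monoʳ-∣ d (a⊆b {w} n∣wa))
  where
  d*[w*x]≡w*[x*d] : ∀ x → d * (w * x) ≡ w * (x * d)
  d*[w*x]≡w*[x*d] x = trans (sym (*-comm (w * x) d)) (*-assoc w x d)
  n∣wa : n ∣ w * a
  n∣wa = *-cancelˡ-∣ d (subst (d * n ∣_) (sym (d*[w*x]≡w*[x*d] a)) dn∣wad)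

ann-comparable-prime-power : ∀ {p} → Prime p → ∀ k u v → AnnComparable (p ^ k) u v
ann-comparable-prime-power pp zero u v = inj₁ λ _ → 1∣ _
ann-comparable-prime-power {p} pp (suc k) u v with p ∣? u | p ∣? v
... | no p∤u | _ = inj₂ λ {w} p^k∣wu → ∣m⇒∣m*n v (prime^-cancelʳ pp p∤u (suc k) {w} p^k∣wu)
... | yes _ | no p∤v = inj₁ λ {w} p^k∣wv → ∣m⇒∣m*n u (prime^-cancelʳ pp p∤v (suc k) {w} p^k∣wv)
... | yes (divides a refl) | yes (divides b refl) =
  Sum.map (ann-⊆-scale p) (ann-⊆-scale p) (ann-comparable-prime-power pp k a b)
  where
  instance
    p≢0 : NonZero p
    p≢0 = prime⇒nonZero pp

p^2≡p*p : ∀ p → p ^ 2 ≡ p * p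
p^2≡p*p p = cong (p *_) (*-identityʳ p)

ann-⊆-twice-odd-prime-square : ∀ {p u v} → Prime p → ¬ 2 ∣ p →
  2 ∣ u → p ∣ u → p ∣ v → ¬ p ^ 2 ∣ v →
  Ann (2 * p ^ 2) v ⊆ Ann (2 * p ^ 2) u
ann-⊆-twice-odd-prime-square {p} pp 2∤p 2∣u (divides a refl) (divides b refl) p²∤v {w} n∣wv =
  ∣-trans (∣-reflexive 2p²≡p*2p) (*-pres-∣ p∣w (*-monoˡ-∣ p 2∣a))
  where
  instance
    p≢0 : NonZero p
    p≢0 = prime⇒nonZero pp
  2p²≡p*2p : 2 * p ^ 2 ≡ p * (2 * p)
  2p²≡p*2p = trans (cong (2 *_) (p^2≡p*p p)) (trans (sym (*-assoc 2 p p)) (*-comm (2 * p) p))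
  2∣a : 2 ∣ a
  2∣a = Sum.[ id , flip contradiction 2∤p ]′ (euclidsLemma a p prime[2] 2∣u)
  p∤b : ¬ p ∣ b
  p∤b (divides c refl) = p²∤v (divides c (trans (*-assoc c p p) (cong (c *_) (sym (p^2≡p*p p)))))
  p∣w*b : p ∣ w * b
  p∣w*b = *-cancelʳ-∣ p (subst₂ _∣_ (p^2≡p*p p) (sym (*-assoc w b p)) (m*n∣⇒n∣ 2 (p ^ 2) n∣wv))
  p∣w : p ∣ w
  p∣w = Sum.[ id , flip contradiction p∤b ]′ (euclidsLemma w b pp p∣w*b)

-- Chords from dominating vertices

CyclicSucc : ℕ → ℕ → ℕ → Set
CyclicSucc k x y = (y ≡ suc x) ⊎ (suc x ≡ k × y ≡ 0)

cyclicSucc²-apart : ∀ {k x y z} → 3 < k → CyclicSucc k x y → CyclicSucc k y z →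
  x ≢ z × ¬ CyclicSucc k x z × ¬ CyclicSucc k z x
cyclicSucc²-apart (s≤s (s≤s (s≤s (s≤s _)))) (inj₁ refl) (inj₁ refl) =
  (λ ()) , (λ { (inj₁ ()) ; (inj₂ (_ , ())) }) , (λ { (inj₁ ()) ; (inj₂ (() , refl)) })
cyclicSucc²-apart (s≤s (s≤s (s≤s (s≤s _)))) (inj₁ refl) (inj₂ (refl , refl)) =
  (λ ()) , (λ { (inj₁ ()) ; (inj₂ (() , _)) }) , (λ { (inj₁ ()) ; (inj₂ (() , _)) })
cyclicSucc²-apart (s≤s (s≤s (s≤s (s≤s _)))) (inj₂ (refl , refl)) (inj₁ refl) =
  (λ ()) , (λ { (inj₁ ()) ; (inj₂ (_ , ())) }) , (λ { (inj₁ ()) ; (inj₂ (() , _)) })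
cyclicSucc²-apart (s≤s (s≤s (s≤s (s≤s _)))) (inj₂ (refl , refl)) (inj₂ (() , _))

Distant : ∀ {k} → Fin k → Fin k → Set
Distant i j = i ≢ j × ¬ Consec i j × ¬ Consec j i

distant-sym : ∀ {k} {i j : Fin k} → Distant i j → Distant j i
distant-sym (i≢j , ¬ij , ¬ji) = i≢j ∘ sym , ¬ji , ¬ij

consec²⇒distant : ∀ {k} {i j l : Fin k} → 3 < k → Consec i j → Consec j l → Distant i l
consec²⇒distant 3<k ij jl with cyclicSucc²-apart 3<k ij jl
... | i≢l , ¬il , ¬li = i≢l ∘ cong toℕ , ¬il , ¬li

Dominates : Graph → ℕ → ℕ → Set
Dominates G u v = ∀ {w} → Graph.Adj G v w → w ≢ u → Graph.Adj G u w

module _ (G : Graph) (adj-sym : ∀ {u v} → Graph.Adj G u v → Graph.Adj G v u) where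
  open Graph G

  chord-at-edge : ∀ {k c} {i₀ i₁ i₂ i₃ : Fin k} → 3 < k → IsCycle G k c →
    Consec i₀ i₁ → Consec i₁ i₂ → Consec i₂ i₃ →
    Dominates G (c i₁) (c i₂) ⊎ Dominates G (c i₂) (c i₁) → HasChord G k c
  chord-at-edge {k} {c} {i₀} {i₁} {i₂} {i₃} 3<k (_ , injective , adj) i₀₁ i₁₂ i₂₃ =
    Sum.[ via-next , via-previous ]
    where
    chord : ∀ {i j} → Distant i j → Adj (c i) (c j) → HasChord G k c
    chord (i≢j , ¬ij , ¬ji) cᵢcⱼ = _ , _ , i≢j , ¬ij , ¬ji , cᵢcⱼ
    apart : ∀ {i j} → Distant i j → c j ≢ c i
    apart (i≢j , _) = i≢j ∘ sym ∘ injective _ _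
    i₁₃ : Distant i₁ i₃
    i₁₃ = consec²⇒distant 3<k i₁₂ i₂₃
    i₂₀ : Distant i₂ i₀
    i₂₀ = distant-sym (consec²⇒distant 3<k i₀₁ i₁₂)
    via-next : Dominates G (c i₁) (c i₂) → HasChord G k c
    via-next dom = chord i₁₃ (dom (adj i₂ i₃ i₂₃) (apart i₁₃))
    via-previous : Dominates G (c i₂) (c i₁) → HasChord G k c
    via-previous dom = chord i₂₀ (dom (adj-sym (adj i₀ i₁ i₀₁)) (apart i₂₀))

  chordal-if-dominating-off : (z : ℕ) →
    (∀ {u v} → Adj u v → u ≢ z → v ≢ z → Dominates G u v ⊎ Dominates G v u) → Chordal G
  chordal-if-dominating-off z dominating k@(suc (suc (suc (suc m)))) 3<k@(s≤s (s≤s (s≤s (s≤s _))))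
    c cyc@(_ , injective , adj) = by-cases (c 1F ≟ z) (c 2F ≟ z)
    where
    last penultimate : Fin k
    last = fromℕ (3 + m)
    penultimate = inject₁ (fromℕ (2 + m))
    penultimate→last : Consec penultimate last
    penultimate→last = inj₁ (cong (3 +_) (sym (toℕ-inject₁ (fromℕ m))))
    last→0 : Consec last 0F
    last→0 = inj₂ (cong (4 +_) (toℕ-fromℕ m) , refl)
    around-0 : ∀ {j} → last ≢ j → 0F ≢ j → c j ≡ z → HasChord G k c
    around-0 {j} last≢j 0≢j cⱼ≡z =
      chord-at-edge 3<k cyc penultimate→last last→0 (inj₁ refl)
        (dominating (adj _ _ last→0) (off last≢j) (off 0≢j))
      where
      off : ∀ {i} → i ≢ j → c i ≢ z
      off i≢j cᵢ≡z = i≢j (injective _ _ (trans cᵢ≡z (sym cⱼ≡z)))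
    -- One of the disjoint edges {1, 2} and {k-1, 0} avoids z.
    by-cases : Dec (c 1F ≡ z) → Dec (c 2F ≡ z) → HasChord G k c
    by-cases (no c₁≢z) (no c₂≢z) =
      chord-at-edge 3<k cyc (inj₁ refl) (inj₁ refl) (inj₁ refl)
        (dominating (adj 1F 2F (inj₁ refl)) c₁≢z c₂≢z)
    by-cases (yes c₁≡z) _ = around-0 (λ ()) (λ ()) c₁≡z
    by-cases (no _) (yes c₂≡z) = around-0 (λ ()) (λ ()) c₂≡z

module _ {n : ℕ} where
  open Graph (Γℤ n)

  Γℤ-adj-sym : ∀ {u v} → Adj u v → Adj v u
  Γℤ-adj-sym {u} {v} (zu , zv , u≢v , n∣uv) = zv , zu , u≢v ∘ sym , subst (n ∣_) (*-comm u v) n∣uv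

  ann-⊆⇒dominates : ∀ {u v} → IsZeroDivisor n u → Ann n v ⊆ Ann n u → Dominates (Γℤ n) u v
  ann-⊆⇒dominates {u} {v} zu v⊆u {w} (_ , zw , _ , n∣vw) w≢u =
    zu , zw , w≢u ∘ sym , subst (n ∣_) (*-comm w u) (v⊆u {w} (subst (n ∣_) (*-comm v w) n∣vw))

  Γℤ-chordal-if-comparable-off : (z : ℕ) →
    (∀ {u v} → Adj u v → u ≢ z → v ≢ z → AnnComparable n u v) → Chordal (Γℤ n)
  Γℤ-chordal-if-comparable-off z comparable = chordal-if-dominating-off (Γℤ n) Γℤ-adj-sym z
    λ uv@(zu , zv , _) u≢z v≢z →
      Sum.map (ann-⊆⇒dominates zu) (ann-⊆⇒dominates zv) (comparable uv u≢z v≢z)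

-- 0 is not a vertex.
prime-power⇒chordal : ∀ {p} → Prime p → ∀ k → Chordal (Γℤ (p ^ k))
prime-power⇒chordal pp k =
  Γℤ-chordal-if-comparable-off 0 λ {u} {v} _ _ _ → ann-comparable-prime-power pp k u v

zero-divisor∧∣⇒≡ : ∀ {d u} → IsZeroDivisor (2 * d) u → d ∣ u → u ≡ d
zero-divisor∧∣⇒≡ (0<u , u<2d , _) d∣u = ∣∧<2*⇒≡ d∣u 0<u u<2d

twice-prime⇒chordal : ∀ {p} → Prime p → Chordal (Γℤ (2 * p))
twice-prime⇒chordal {p} pp = Γℤ-chordal-if-comparable-off p every-edge-meets-p
  where
  every-edge-meets-p : ∀ {u v} → Graph.Adj (Γℤ (2 * p)) u v → u ≢ p → v ≢ p →
    AnnComparable (2 * p) u v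
  every-edge-meets-p {u} {v} (zu , zv , _ , 2p∣uv) u≢p v≢p = ⊥-elim
    (Sum.[ u≢p ∘ zero-divisor∧∣⇒≡ zu , v≢p ∘ zero-divisor∧∣⇒≡ zv ]′
      (euclidsLemma u v pp (∣-trans (n∣m*n 2) 2p∣uv)))

twice-odd-prime-square⇒chordal : ∀ {p} → Prime p → ¬ 2 ∣ p → Chordal (Γℤ (2 * p ^ 2))
twice-odd-prime-square⇒chordal {p} pp 2∤p = Γℤ-chordal-if-comparable-off (p ^ 2) comparable
  where
  n : ℕ
  n = 2 * p ^ 2
  p²∤ : ∀ {w} → IsZeroDivisor n w → w ≢ p ^ 2 → ¬ p ^ 2 ∣ w
  p²∤ zw w≢p² = w≢p² ∘ zero-divisor∧∣⇒≡ zw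
  p∣ : ∀ {w w′} → IsZeroDivisor n w′ → w′ ≢ p ^ 2 → n ∣ w * w′ → p ∣ w
  p∣ {w} {w′} zw′ w′≢p² n∣ww′ with p ∣? w
  ... | yes p∣w = p∣w
  ... | no p∤w = contradiction
    (prime^-cancelʳ pp p∤w 2 (subst (p ^ 2 ∣_) (*-comm w w′) (m*n∣⇒n∣ 2 (p ^ 2) n∣ww′)))
    (p²∤ zw′ w′≢p²)
  comparable : ∀ {u v} → Graph.Adj (Γℤ n) u v → u ≢ p ^ 2 → v ≢ p ^ 2 → AnnComparable n u v
  comparable {u} {v} (zu , zv , _ , n∣uv) u≢p² v≢p² =
    Sum.map (λ 2∣u {w} → ann-⊆-twice-odd-prime-square pp 2∤p 2∣u p∣u p∣v (p²∤ zv v≢p²) {w})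
            (λ 2∣v {w} → ann-⊆-twice-odd-prime-square pp 2∤p 2∣v p∣v p∣u (p²∤ zu u≢p²) {w})
            (euclidsLemma u v prime[2] (∣-trans (m∣m*n (p ^ 2)) n∣uv))
    where
    p∣u : p ∣ u
    p∣u = p∣ zv v≢p² n∣uv
    p∣v : p ∣ v
    p∣v = p∣ zu u≢p² (subst (n ∣_) (*-comm u v) n∣uv)

-- Induced 4-cycles

NonzeroResidue : ℕ → ℕ → Set
NonzeroResidue n a = 0 < a × a < n

record ChordlessSquare (n : ℕ) : Set where
  field
    x₁ x₂ y₁ y₂ : ℕ
    x₁-res : NonzeroResidue n x₁
    x₂-res : NonzeroResidue n x₂
    y₁-res : NonzeroResidue n y₁
    y₂-res : NonzeroResidue n y₂
    x₁≢x₂ : x₁ ≢ x₂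
    y₁≢y₂ : y₁ ≢ y₂
    x₁y₁ : n ∣ x₁ * y₁
    x₁y₂ : n ∣ x₁ * y₂
    x₂y₁ : n ∣ x₂ * y₁
    x₂y₂ : n ∣ x₂ * y₂
    x₁x₂ : ¬ n ∣ x₁ * x₂
    y₁y₂ : ¬ n ∣ y₁ * y₂

rotate : Fin 4 → Fin 4
rotate 0F = 1F
rotate 1F = 2F
rotate 2F = 3F
rotate 3F = 0F

consec⇒≡rotate : ∀ i {j : Fin 4} → Consec i j → j ≡ rotate i
consec⇒≡rotate 0F (inj₁ 1≡j) = toℕ-injective 1≡j
consec⇒≡rotate 1F (inj₁ 2≡j) = toℕ-injective 2≡j
consec⇒≡rotate 2F (inj₁ 3≡j) = toℕ-injective 3≡j
consec⇒≡rotate 3F {j} (inj₁ j≡4) = contradiction j≡4 (<⇒≢ (toℕ<n j))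
consec⇒≡rotate 3F (inj₂ (_ , j≡0)) = toℕ-injective j≡0

module Square {n} (S : ChordlessSquare n) where
  open ChordlessSquare S
  open Graph (Γℤ n)

  n∣-comm : ∀ a b → n ∣ a * b → n ∣ b * a
  n∣-comm a b = subst (n ∣_) (*-comm a b)

  x₁≢y₁ : x₁ ≢ y₁
  x₁≢y₁ e = x₁x₂ (n∣-comm x₂ x₁ (subst (λ t → n ∣ x₂ * t) (sym e) x₂y₁))
  x₁≢y₂ : x₁ ≢ y₂
  x₁≢y₂ e = x₁x₂ (n∣-comm x₂ x₁ (subst (λ t → n ∣ x₂ * t) (sym e) x₂y₂))
  x₂≢y₁ : x₂ ≢ y₁
  x₂≢y₁ e = x₁x₂ (subst (λ t → n ∣ x₁ * t) (sym e) x₁y₁)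
  x₂≢y₂ : x₂ ≢ y₂
  x₂≢y₂ e = x₁x₂ (subst (λ t → n ∣ x₁ * t) (sym e) x₁y₂)

  corner : Fin 4 → ℕ
  corner 0F = x₁
  corner 1F = y₁
  corner 2F = x₂
  corner 3F = y₂

  corner-injective : ∀ i j → corner i ≡ corner j → i ≡ j
  corner-injective 0F 0F _ = refl
  corner-injective 0F 1F e = contradiction e x₁≢y₁
  corner-injective 0F 2F e = contradiction e x₁≢x₂
  corner-injective 0F 3F e = contradiction e x₁≢y₂
  corner-injective 1F 0F e = contradiction (sym e) x₁≢y₁
  corner-injective 1F 1F _ = refl
  corner-injective 1F 2F e = contradiction (sym e) x₂≢y₁
  corner-injective 1F 3F e = contradiction e y₁≢y₂
  corner-injective 2F 0F e = contradiction (sym e) x₁≢x₂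
  corner-injective 2F 1F e = contradiction e x₂≢y₁
  corner-injective 2F 2F _ = refl
  corner-injective 2F 3F e = contradiction e x₂≢y₂
  corner-injective 3F 0F e = contradiction (sym e) x₁≢y₂
  corner-injective 3F 1F e = contradiction (sym e) y₁≢y₂
  corner-injective 3F 2F e = contradiction (sym e) x₂≢y₂
  corner-injective 3F 3F _ = refl

  edge : ∀ {a b} → NonzeroResidue n a → NonzeroResidue n b → a ≢ b → n ∣ a * b → Adj a b
  edge {a} {b} (0<a , a<n) (0<b , b<n) a≢b n∣ab =
    (0<a , a<n , _ , 0<b , b<n , n∣ab) , (0<b , b<n , _ , 0<a , a<n , n∣-comm a b n∣ab) , a≢b , n∣ab

  corner-edge : ∀ i → Adj (corner i) (corner (rotate i))
  corner-edge 0F = edge x₁-res y₁-res x₁≢y₁ x₁y₁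
  corner-edge 1F = edge y₁-res x₂-res (x₂≢y₁ ∘ sym) (n∣-comm x₂ y₁ x₂y₁)
  corner-edge 2F = edge x₂-res y₂-res x₂≢y₂ x₂y₂
  corner-edge 3F = edge y₂-res x₁-res (x₁≢y₂ ∘ sym) (n∣-comm x₁ y₂ x₁y₂)

  corner-cycle : IsCycle (Γℤ n) 4 corner
  corner-cycle = proj₁ ∘ corner-edge , corner-injective , λ i j i→j →
    subst (Adj (corner i) ∘ corner) (sym (consec⇒≡rotate i i→j)) (corner-edge i)

  corner-chordless : ¬ HasChord (Γℤ n) 4 corner
  corner-chordless (0F , 0F , i≢j , _) = i≢j refl
  corner-chordless (0F , 1F , _ , ¬ij , _) = ¬ij (inj₁ refl)
  corner-chordless (0F , 2F , _ , _ , _ , _ , _ , _ , n∣x₁x₂) = x₁x₂ n∣x₁x₂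
  corner-chordless (0F , 3F , _ , _ , ¬ji , _) = ¬ji (inj₂ (refl , refl))
  corner-chordless (1F , 0F , _ , _ , ¬ji , _) = ¬ji (inj₁ refl)
  corner-chordless (1F , 1F , i≢j , _) = i≢j refl
  corner-chordless (1F , 2F , _ , ¬ij , _) = ¬ij (inj₁ refl)
  corner-chordless (1F , 3F , _ , _ , _ , _ , _ , _ , n∣y₁y₂) = y₁y₂ n∣y₁y₂
  corner-chordless (2F , 0F , _ , _ , _ , _ , _ , _ , n∣x₂x₁) = x₁x₂ (n∣-comm x₂ x₁ n∣x₂x₁)
  corner-chordless (2F , 1F , _ , _ , ¬ji , _) = ¬ji (inj₁ refl)
  corner-chordless (2F , 2F , i≢j , _) = i≢j refl
  corner-chordless (2F , 3F , _ , ¬ij , _) = ¬ij (inj₁ refl)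
  corner-chordless (3F , 0F , _ , ¬ij , _) = ¬ij (inj₂ (refl , refl))
  corner-chordless (3F , 1F , _ , _ , _ , _ , _ , _ , n∣y₂y₁) = y₁y₂ (n∣-comm y₂ y₁ n∣y₂y₁)
  corner-chordless (3F , 2F , _ , _ , ¬ji , _) = ¬ji (inj₁ refl)
  corner-chordless (3F , 3F , i≢j , _) = i≢j refl

square⇒¬chordal : ∀ {n} → ChordlessSquare n → ¬ Chordal (Γℤ n)
square⇒¬chordal S chordal = corner-chordless (chordal 4 ≤-refl corner corner-cycle)
  where open Square S

mutually-nondividing⇒¬chordal : ∀ {P M} → ¬ P ∣ 2 * M → ¬ M ∣ 2 * P → ¬ Chordal (Γℤ (P * M))
mutually-nondividing⇒¬chordal {P} {M} P∤2M M∤2P = square⇒¬chordal record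
  { x₁ = M ; x₂ = 2 * M ; y₁ = P ; y₂ = 2 * P
  ; x₁-res = 0<M , m<n*m M (<-trans (s≤s (s≤s z≤n)) 2<P)
  ; x₂-res = *-monoʳ-< 2 0<M , *-monoˡ-< M 2<P
  ; y₁-res = 0<P , m<m*n P M (<-trans (s≤s (s≤s z≤n)) 2<M)
  ; y₂-res = *-monoʳ-< 2 0<P , subst (2 * P <_) (*-comm M P) (*-monoˡ-< P 2<M)
  ; x₁≢x₂ = <⇒≢ (m<n*m M ≤-refl)
  ; y₁≢y₂ = <⇒≢ (m<n*m P ≤-refl)
  ; x₁y₁ = PM∣MP
  ; x₁y₂ = ∣-trans PM∣MP (*-monoʳ-∣ M (n∣m*n 2 {P}))
  ; x₂y₁ = ∣-trans PM∣MP (*-monoˡ-∣ P (n∣m*n 2 {M}))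
  ; x₂y₂ = ∣-trans PM∣MP (*-pres-∣ (n∣m*n 2 {M}) (n∣m*n 2 {P}))
  ; x₁x₂ = P∤2M ∘ *-cancelʳ-∣ M ∘ subst (P * M ∣_) (*-comm M (2 * M))
  ; y₁y₂ = M∤2P ∘ *-cancelˡ-∣ P
  }
  where
  0<M : 0 < M
  0<M = ∤2*⇒0< P∤2M
  0<P : 0 < P
  0<P = ∤2*⇒0< M∤2P
  instance
    M≢0 : NonZero M
    M≢0 = >-nonZero 0<M
    P≢0 : NonZero P
    P≢0 = >-nonZero 0<P
  2<P : 2 < P
  2<P = ∤2*⇒3≤ {m = M} 0<P P∤2M
  2<M : 2 < M
  2<M = ∤2*⇒3≤ {m = P} 0<M M∤2P
  PM∣MP : P * M ∣ M * P
  PM∣MP = ∣-reflexive (*-comm P M)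

¬chordal-2pQ : ∀ {p Q} → 1 < p → ¬ 2 ∣ Q → ¬ Q ∣ 4 * p → ¬ Chordal (Γℤ (2 * p * Q))
¬chordal-2pQ {p} {Q} 1<p 2∤Q Q∤4p = square⇒¬chordal record
  { x₁ = 2 * p ; x₂ = 4 * p ; y₁ = Q ; y₂ = 3 * Q
  ; x₁-res = 0<2p , m<m*n (2 * p) Q (<-trans (s≤s (s≤s z≤n)) 2<Q)
  ; x₂-res = *-monoʳ-< 4 0<p , subst (_< 2 * p * Q) (sym 4p≡2p*2) (*-monoʳ-< (2 * p) 2<Q)
  ; y₁-res = 0<Q , m<n*m Q (<-trans (s≤s (s≤s z≤n)) 3<2p)
  ; y₂-res = *-monoʳ-< 3 0<Q , *-monoˡ-< Q 3<2p
  ; x₁≢x₂ = <⇒≢ (*-monoˡ-< p {2} {4} (s≤s (s≤s (s≤s z≤n))))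
  ; y₁≢y₂ = <⇒≢ (m<n*m Q {3} (s≤s (s≤s z≤n)))
  ; x₁y₁ = ∣-refl
  ; x₁y₂ = *-monoʳ-∣ (2 * p) (n∣m*n 3 {Q})
  ; x₂y₁ = *-monoˡ-∣ Q 2p∣4p
  ; x₂y₂ = *-pres-∣ 2p∣4p (n∣m*n 3 {Q})
  ; x₁x₂ = Q∤4p ∘ *-cancelˡ-∣ (2 * p)
  ; y₁y₂ = 2∤Q*3Q ∘ ∣-trans (∣-trans (m∣m*n p) (m∣m*n Q))
  }
  where
  0<p : 0 < p
  0<p = <-trans (s≤s z≤n) 1<p
  instance
    p≢0 : NonZero p
    p≢0 = >-nonZero 0<p
  0<2p : 0 < 2 * p
  0<2p = *-monoʳ-< 2 0<p
  instance
    2p≢0 : NonZero (2 * p)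
    2p≢0 = >-nonZero 0<2p
  3<2p : 3 < 2 * p
  3<2p = *-monoʳ-≤ 2 1<p
  4p≡2p*2 : 4 * p ≡ 2 * p * 2
  4p≡2p*2 = trans (*-assoc 2 2 p) (*-comm 2 (2 * p))
  0<Q : 0 < Q
  0<Q = n≢0⇒n>0 λ Q≡0 → 2∤Q (subst (2 ∣_) (sym Q≡0) (2 ∣0))
  instance
    Q≢0 : NonZero Q
    Q≢0 = >-nonZero 0<Q
  2<Q : 2 < Q
  2<Q = ∤2*⇒3≤ {m = 2 * p} 0<Q (Q∤4p ∘ subst (Q ∣_) (sym (*-assoc 2 2 p)))
  2p∣4p : 2 * p ∣ 4 * p
  2p∣4p = *-monoˡ-∣ p (divides {2} {4} 2 refl)
  2∤Q*3Q : ¬ 2 ∣ Q * (3 * Q)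
  2∤Q*3Q 2∣Q*3Q with euclidsLemma Q (3 * Q) prime[2] 2∣Q*3Q
  ... | inj₁ 2∣Q = 2∤Q 2∣Q
  ... | inj₂ 2∣3Q = Sum.[ from-no (2 ∣? 3) , 2∤Q ]′ (euclidsLemma 3 Q prime[2] 2∣3Q)

Power⊎2p⊎2p² : ℕ → Set
Power⊎2p⊎2p² n =
  ∃[ p ] (Prime p × ((∃[ x ] (1 ≤ x × n ≡ p ^ x)) ⊎ (n ≡ 2 * p) ⊎ (n ≡ 2 * p ^ 2)))

power-of-2-or-odd-prime-divisor : ∀ {n} → 0 < n →
  (∃[ a ] n ≡ 2 ^ a) ⊎ (∃[ p ] (Prime p × ¬ 2 ∣ p × p ∣ n))
power-of-2-or-odd-prime-divisor 0<n with prime-power-decomposition prime[2] 0<n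
... | _ , zero , _ , 2∤0 = contradiction (2 ∣0) 2∤0
... | a , suc zero , n≡2^a*1 , _ = inj₁ (a , trans n≡2^a*1 (*-identityʳ (2 ^ a)))
... | a , m@(suc (suc _)) , n≡2^a*m , 2∤m with ∃-prime-divisor {m} (s≤s (s≤s z≤n))
...   | p , pp , p∣m =
  inj₂ (p , pp , 2∤m ∘ flip ∣-trans p∣m , subst (p ∣_) (sym n≡2^a*m) (∣n⇒∣m*n (2 ^ a) p∣m))

chordal-twice-odd-prime-power : ∀ {p} → Prime p → ¬ 2 ∣ p → ∀ b → Chordal (Γℤ (p ^ suc b * 2)) →
  (p ^ suc b * 2 ≡ 2 * p) ⊎ (p ^ suc b * 2 ≡ 2 * p ^ 2)
chordal-twice-odd-prime-power {p} _ _ zero _ = inj₁ (trans (*-comm (p ^ 1) 2) (cong (2 *_) (*-identityʳ p)))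
chordal-twice-odd-prime-power {p} _ _ (suc zero) _ = inj₂ (*-comm (p ^ 2) 2)
chordal-twice-odd-prime-power {p} pp 2∤p (suc (suc c)) chordal =
  contradiction (subst (Chordal ∘ Γℤ) p^[3+c]*2≡2*p*Q chordal) (¬chordal-2pQ (prime⇒2≤ pp) 2∤Q Q∤4p)
  where
  Q : ℕ
  Q = p ^ (2 + c)
  p^[3+c]*2≡2*p*Q : p * Q * 2 ≡ 2 * p * Q
  p^[3+c]*2≡2*p*Q = trans (*-comm (p * Q) 2) (sym (*-assoc 2 p Q))
  2∤Q : ¬ 2 ∣ Q
  2∤Q = 2∤p ∘ prime∣^⇒∣ prime[2] (2 + c)
  Q∤4p : ¬ Q ∣ 4 * p
  Q∤4p Q∣4p = odd-prime∤2* pp 2∤p (odd-prime∤2 pp 2∤p)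
    (∣-trans (m∣m*n (p ^ c)) (*-cancelˡ-∣ p {{prime⇒nonZero pp}} (subst (Q ∣_) (*-comm 4 p) Q∣4p)))

chordal-with-odd-prime-divisor : ∀ {p b M} → Prime p → ¬ 2 ∣ p → ¬ p ∣ M → p ∣ p ^ b * M →
  Chordal (Γℤ (p ^ b * M)) → Power⊎2p⊎2p² (p ^ b * M)
chordal-with-odd-prime-divisor {p} {zero} {M} _ _ p∤M p∣1*M _ =
  contradiction (subst (p ∣_) (*-identityˡ M) p∣1*M) p∤M
chordal-with-odd-prime-divisor {p} {suc b} {M} pp 2∤p p∤M _ chordal with M ∣? 2 * p ^ suc b
... | no M∤2P = contradiction chordal (mutually-nondividing⇒¬chordal P∤2M M∤2P)
  where
  P∤2M : ¬ p ^ suc b ∣ 2 * M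
  P∤2M = odd-prime∤2* pp 2∤p p∤M ∘ ∣-trans (m∣m*n (p ^ b))
... | yes M∣2P
  with prime⇒irreducible prime[2] (∣p^*⇒∣ pp p∤M (suc b) (subst (M ∣_) (*-comm 2 (p ^ suc b)) M∣2P))
...   | inj₁ refl = p , pp , inj₁ (suc b , s≤s z≤n , *-identityʳ (p ^ suc b))
...   | inj₂ refl = p , pp , inj₂ (chordal-twice-odd-prime-power pp 2∤p b chordal)

chordal⇒power⊎2p⊎2p² : ∀ {n} → 2 ≤ n → Chordal (Γℤ n) → Power⊎2p⊎2p² n
chordal⇒power⊎2p⊎2p² 2≤n chordal with power-of-2-or-odd-prime-divisor (<-trans z<s 2≤n)
... | inj₁ (zero , refl) = contradiction 2≤n λ { (s≤s ()) }
... | inj₁ (suc a , refl) = 2 , prime[2] , inj₁ (suc a , s≤s z≤n , refl)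
... | inj₂ (p , pp , 2∤p , p∣n) with prime-power-decomposition pp (<-trans z<s 2≤n)
...   | b , M , refl , p∤M = chordal-with-odd-prime-divisor {b = b} pp 2∤p p∤M p∣n chordal

power⊎2p⊎2p²⇒chordal : ∀ {n} → Power⊎2p⊎2p² n → Chordal (Γℤ n)
power⊎2p⊎2p²⇒chordal (p , pp , inj₁ (k , _ , refl)) = prime-power⇒chordal pp k
power⊎2p⊎2p²⇒chordal (p , pp , inj₂ (inj₁ refl)) = twice-prime⇒chordal pp
power⊎2p⊎2p²⇒chordal (p , pp , inj₂ (inj₂ refl)) with 2 ∣? p
... | no 2∤p = twice-odd-prime-square⇒chordal pp 2∤p
... | yes 2∣p with prime∣prime⇒≡ prime[2] pp 2∣p
...   | refl = prime-power⇒chordal prime[2] 3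

theorem2p16 : (n : ℕ) → 2 ≤ n →
    Chordal (Γℤ n) ⇔
      (∃[ p ] (Prime p ×
        ((∃[ x ] (1 ≤ x × n ≡ p ^ x)) ⊎ (n ≡ 2 * p) ⊎ (n ≡ 2 * p ^ 2))))
theorem2p16 n 2≤n = mk⇔ (chordal⇒power⊎2p⊎2p² 2≤n) power⊎2p⊎2p²⇒chordal
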